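{- Let $T$ be the complete binary tree with $n$ vertices. Then $\mathrm{AC}(T)=O(n\log n)$.
   Context: The complete binary tree of depth $h$ has vertex set $\{v_s: s\in\{0,1\}^{\le h}\}$ (binary strings of length at most $h$), with $v_s$ adjacent to $v_{s0}$ and $v_{s1}$; it has $n=2^{h+1}-1$ vertices. Acquaintance time: for a connected graph, place one agent on each vertex. Two agents are acquainted once they occupy the two endpoints of a common edge at some time (including the initial placement). In each round one chooses a matching (set of pairwise vertex-disjoint edges, not necessarily maximal), and for every edge of it the two agents on its endpoints swap places. A strategy for acquaintance is a sequence of matchings after which every pair of agents has been acquainted; $\mathrm{AC}(G)$ is the minimum number of rounds in such a strategy. -}

module Defs where

open import Data.Nat using (ℕ; _≤_; _∸_; _^_; _*_; _+_)
open import Data.Bool using (Bool)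
open import Data.List using (List; []; _∷_; _++_; [_]; length)
open import Data.List.Relation.Unary.All using (All)
open import Data.List.Relation.Unary.Any using (Any)
open import Data.Product using (Σ; ∃; ∃-syntax; _×_; _,_; proj₁)
open import Data.Sum using (_⊎_)
open import Relation.Binary.PropositionalEquality using (_≡_; _≢_)
open import Function using (id; _∘_)

record Graph : Set₁ where
  field
    V   : Set
    Adj : V → V → Set
open Graph public

-- A matching, encoded as the map sending each matched vertex to its partner
-- and each unmatched vertex to itself: an involution moving vertices only
-- along edges.  (Equivalent to a set of pairwise vertex-disjoint edges.)
IsMatching : (G : Graph) → (V G → V G) → Set
IsMatching G μ = (∀ v → μ (μ v) ≡ v) × (∀ v → μ v ≡ v ⊎ Adj G v (μ v))

-- Agents are named by their initial vertex.  A configuration c : V → V maps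
-- each vertex to the agent currently standing on it.  Performing the swaps of
-- a matching μ turns c into c ∘ μ.  'configs c ms' lists the configurations
-- at times 0, 1, ..., length ms.
configs : {A : Set} → (A → A) → List (A → A) → List (A → A)
configs c []       = c ∷ []
configs c (μ ∷ ms) = c ∷ configs (c ∘ μ) ms

Acquainted : (G : Graph) → List (V G → V G) → V G → V G → Set
Acquainted G ms a b =
  Any (λ c → ∃[ u ] ∃[ w ] (Adj G u w × c u ≡ a × c w ≡ b)) (configs id ms)

IsStrategy : (G : Graph) → List (V G → V G) → Set
IsStrategy G ms = All (IsMatching G) ms × (∀ a b → a ≢ b → Acquainted G ms a b)

-- AC(G) ≤ k  (AC is the minimum length of a strategy).
AC≤ : Graph → ℕ → Set
AC≤ G k = ∃[ ms ] (IsStrategy G ms × length ms ≤ k)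

TVert : ℕ → Set
TVert h = Σ (List Bool) (λ s → length s ≤ h)

TChild : {h : ℕ} → TVert h → TVert h → Set
TChild u w = ∃[ b ] (proj₁ w ≡ proj₁ u ++ [ b ])

TreeAdj : {h : ℕ} → TVert h → TVert h → Set
TreeAdj u w = TChild u w ⊎ TChild w u

Tree : ℕ → Graph
Tree h = record { V = TVert h ; Adj = TreeAdj }

treeSize : ℕ → ℕ
treeSize h = 2 ^ (h + 1) ∸ 1

module Submission where

-- Idea: simulate odd–even transposition ("brick") sort on a virtual path
-- through the tree.  The path lists the root, then the left subtree, then
-- the right subtree, each subtree traversed in reverse (rank / corank).  On
-- a path with an odd number N of positions, N brick rounds reverse the path,
-- so any two agents are exchanged, and hence adjacent, at some round.  One
-- brick round of the virtual path is performed on the tree by 5h matchings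
-- (brickSchedule): a five-round gadget exchanging the only pair straddling
-- the border between root, left and right subtree, followed recursively by
-- the corresponding rounds inside both subtrees.  Every pair it exchanges is
-- adjacent in the tree at some moment, so n·5h = O(n log n) rounds suffice.

open import Data.Bool using (Bool; true; false; not)
import Data.Bool as Bool
open import Data.Bool.Properties using (not-involutive; not-injective; not-¬; ¬-not)
open import Data.Nat using (ℕ; zero; suc; _+_; _*_; _^_; _∸_; _≤_; _<_; pred; z≤n; s≤s; _<?_; _≟_)
open import Data.Nat.Properties
open import Data.Nat.Logarithm using (⌊log₂_⌋; ⌊log₂⌋-mono-≤; ⌊log₂[2^n]⌋≡n)
open import Data.Nat.Tactic.RingSolver using (solve-∀)
open import Data.Product using (∃-syntax; _×_; _,_; proj₁; proj₂)
open import Data.Sum using (_⊎_; inj₁; inj₂)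
open import Data.List using (List; []; _∷_; _++_; length; map)
open import Data.List.Properties using (length-++; length-map)
open import Data.List.Relation.Unary.Any using (Any; here; there)
open import Data.List.Relation.Unary.All using (All; []; _∷_)
import Data.List.Relation.Unary.All as All
open import Data.List.Relation.Unary.All.Properties using (++⁺; map⁺)
open import Function using (id; _∘_)
open import Relation.Nullary using (¬_; Dec; yes; no; contradiction)
open import Relation.Unary using (Decidable)
open import Relation.Binary using (tri<; tri≈; tri>)
open import Relation.Binary.PropositionalEquality
open import Defs

isEven : ℕ → Bool
isEven zero    = true
isEven (suc n) = not (isEven n)

isEven-+-even : ∀ a b → isEven a ≡ true → isEven (a + b) ≡ isEven b
isEven-+-odd  : ∀ a b → isEven a ≡ false → isEven (a + b) ≡ not (isEven b)
isEven-+-even zero    b _ = refl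
isEven-+-even (suc a) b e =
  trans (cong not (isEven-+-odd a b (not-injective e))) (not-involutive (isEven b))
isEven-+-odd  (suc a) b e = cong not (isEven-+-even a b (not-injective e))

isEven-double : ∀ a → isEven (a + a) ≡ true
isEven-double a with isEven a in e
... | true  = trans (isEven-+-even a a e) e
... | false = trans (isEven-+-odd a a e) (cong not e)

isEven-summands : ∀ a b → isEven (a + b) ≡ true → isEven a ≡ isEven b
isEven-summands a b s with isEven a in e
... | true  = trans (sym s) (isEven-+-even a b e)
... | false = sym (not-injective (trans (sym (isEven-+-odd a b e)) s))

-- One round of odd–even transposition ("brick") sort on the path
-- 0 — 1 — … — N-1: for every i with isEven i ≡ p and i+1 < N the
-- positions i and i+1 are exchanged.  brick p N i is the new place of
-- whatever stood on i.
brick : Bool → ℕ → ℕ → ℕ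
brick p N i with isEven i Bool.≟ p | suc i <? N
... | yes _ | yes _ = suc i
... | yes _ | no  _ = i
... | no  _ | _     = pred i

module _ {p : Bool} {N i : ℕ} where

  brick-up : isEven i ≡ p → suc i < N → brick p N i ≡ suc i
  brick-up e q with isEven i Bool.≟ p | suc i <? N
  ... | yes _ | yes _ = refl
  ... | yes _ | no ¬q = contradiction q ¬q
  ... | no ¬e | _     = contradiction e ¬e

  brick-stay : isEven i ≡ p → N ≤ suc i → brick p N i ≡ i
  brick-stay e q with isEven i Bool.≟ p | suc i <? N
  ... | yes _ | yes r = contradiction q (<⇒≱ r)
  ... | yes _ | no  _ = refl
  ... | no ¬e | _     = contradiction e ¬e

  brick-down : isEven i ≡ not p → brick p N i ≡ pred i
  brick-down e with isEven i Bool.≟ p | suc i <? N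
  ... | yes e′ | _ = contradiction (trans (sym e′) e) (not-¬ refl)
  ... | no  _  | _ = refl

  data BrickView : Set where
    up   : isEven i ≡ p     → suc i < N → brick p N i ≡ suc i → BrickView
    stay : isEven i ≡ p     → N ≤ suc i → brick p N i ≡ i     → BrickView
    down : isEven i ≡ not p →             brick p N i ≡ pred i → BrickView

  brickView : BrickView
  brickView with isEven i Bool.≟ p | suc i <? N
  ... | yes e  | yes q = up e q (brick-up e q)
  ... | yes e  | no ¬q = stay e (≮⇒≥ ¬q) (brick-stay e (≮⇒≥ ¬q))
  ... | no ¬e  | _     = down e′ (brick-down e′)
    where
    e′ : isEven i ≡ not p
    e′ = ¬-not ¬e

brick-< : ∀ p N i → i < N → brick p N i < N
brick-< p N i i<N with brickView {p} {N} {i}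
... | up   _ q e = subst (_< N) (sym e) q
... | stay _ _ e = subst (_< N) (sym e) i<N
... | down _   e = subst (_< N) (sym e) (≤-<-trans pred[n]≤n i<N)

brick-≤ : ∀ p N i → brick p N i ≤ suc i
brick-≤ p N i with brickView {p} {N} {i}
... | up   _ _ e = ≤-reflexive e
... | stay _ _ e = ≤-trans (≤-reflexive e) (n≤1+n i)
... | down _   e = ≤-trans (≤-reflexive e) (≤-trans pred[n]≤n (n≤1+n i))

brick-≥ : ∀ p N i → i ≤ suc (brick p N i)
brick-≥ p N i with brickView {p} {N} {i}
... | up   _ _ e = ≤-trans (n≤1+n i) (≤-trans (n≤1+n (suc i)) (s≤s (≤-reflexive (sym e))))
... | stay _ _ e = ≤-trans (n≤1+n i) (s≤s (≤-reflexive (sym e)))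
... | down _   e = subst (λ j → i ≤ suc j) (sym e) (≤-suc-pred i)
  where
  ≤-suc-pred : ∀ n → n ≤ suc (pred n)
  ≤-suc-pred zero    = z≤n
  ≤-suc-pred (suc n) = ≤-refl

brick-involutive : ∀ p N i → i < N → brick p N (brick p N i) ≡ i
brick-involutive p N i i<N with brickView {p} {N} {i}
... | up   e _ b = trans (cong (brick p N) b) (brick-down (cong not e))
... | stay _ _ b = trans (cong (brick p N) b) b
... | down e b with i
...   | zero   = trans (cong (brick p N) b) b
...   | suc j  = trans (cong (brick p N) b) (brick-up (not-injective e) i<N)

brick-fixed : ∀ p N i → brick p N i ≡ i → (p ≡ false × i ≡ 0) ⊎ (isEven i ≡ p × N ≤ suc i)
brick-fixed p N i f with brickView {p} {N} {i}
... | up   _ _ b = contradiction (trans (sym b) f) 1+n≢n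
... | stay e q _ = inj₂ (e , q)
... | down e b with i
...   | zero  = inj₁ (not-injective (sym e) , refl)
...   | suc j = contradiction (trans (sym f) b) 1+n≢n

-- Reflecting the path i ↦ M - i (M even) exchanges the two parities of
-- rounds: a p-round seen from the other end is a (not p)-round.
brick-reflect : ∀ M → isEven M ≡ true → ∀ p k k′ → k + k′ ≡ M →
                brick p (suc M) k + brick (not p) (suc M) k′ ≡ M
brick-reflect M evM p k k′ s = reflect k k′ s (brickView {p} {suc M} {k})
  where
  open ≡-Reasoning
  N : ℕ
  N = suc M

  sameParity : ∀ k k′ → k + k′ ≡ M → isEven k′ ≡ isEven k
  sameParity k k′ s = sym (isEven-summands k k′ (trans (cong isEven s) evM))

  flip : ∀ {a b : Bool} → a ≡ b → b ≡ p → a ≡ not (not p)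
  flip sp e = trans sp (trans e (sym (not-involutive p)))

  reflect : ∀ k k′ → k + k′ ≡ M → BrickView {p} {N} {k} →
            brick p N k + brick (not p) N k′ ≡ M
  reflect k zero s (up _ (s≤s q) _) =
    contradiction (trans (sym (+-identityʳ k)) s) (<⇒≢ q)
  reflect k (suc k″) s (up e _ b) = begin
    brick p N k + brick (not p) N (suc k″)
      ≡⟨ cong₂ _+_ b (brick-down {not p} {N} {suc k″} (flip (sameParity k (suc k″) s) e)) ⟩
    suc k + k″   ≡⟨ sym (+-suc k k″) ⟩
    k + suc k″   ≡⟨ s ⟩
    M            ∎
  reflect k zero s (stay e _ b) =
    trans (cong₂ _+_ b (brick-down {not p} {N} {0} (flip (sameParity k zero s) e))) s
  reflect k (suc k″) s (stay _ (s≤s q) _) =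
    contradiction (≤-trans (≤-reflexive s) q) (m+1+n≰m k)
  reflect zero k′ s (down e b) =
    trans (cong₂ _+_ b (brick-stay (trans (sameParity 0 k′ s) e) (≤-reflexive (cong suc (sym s))))) s
  reflect (suc k₀) k′ s (down e b) = begin
    brick p N (suc k₀) + brick (not p) N k′
      ≡⟨ cong₂ _+_ b (brick-up (trans (sameParity (suc k₀) k′ s) e) k′+1<N) ⟩
    k₀ + suc k′  ≡⟨ +-suc k₀ k′ ⟩
    suc k₀ + k′  ≡⟨ s ⟩
    M            ∎
    where
    k′+1<N : suc k′ < N
    k′+1<N = s≤s (subst (suc k′ ≤_) s (s≤s (m≤n+m k′ k₀)))

-- A block of consecutive positions k, k+1, …, k+m-1 inside a path of N
-- positions, whose round parity q corresponds to p on the whole path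
-- (offset k maps the q-class onto the p-class): wherever the block round
-- moves a position, the round on the whole path moves it alike.
brick-shift : ∀ p q k m N j →
              (∀ i → isEven i ≡ q → isEven (k + i) ≡ p) →
              (∀ i → isEven i ≡ not q → isEven (k + i) ≡ not p) →
              k + m ≤ N → brick q m j ≢ j → brick p N (k + j) ≡ k + brick q m j
brick-shift p q k m N j same opposite k+m≤N moves with brickView {q} {m} {j}
... | up e j+1<m b = begin
  brick p N (k + j)  ≡⟨ brick-up (same j e) (≤-trans k+j+1<k+m k+m≤N) ⟩
  suc (k + j)        ≡⟨ sym (+-suc k j) ⟩
  k + suc j          ≡⟨ cong (k +_) (sym b) ⟩
  k + brick q m j    ∎
  where
  open ≡-Reasoning
  k+j+1<k+m : suc (k + j) < k + m
  k+j+1<k+m = subst (_< k + m) (+-suc k j) (+-monoʳ-< k j+1<m)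
... | stay _ _ b = contradiction b moves
... | down e b with j
...   | zero   = contradiction b moves
...   | suc j′ = begin
  brick p N (k + suc j′)   ≡⟨ brick-down {N = N} {i = k + suc j′} (opposite (suc j′) e) ⟩
  pred (k + suc j′)        ≡⟨ cong pred (+-suc k j′) ⟩
  k + j′                   ≡⟨ cong (k +_) (sym b) ⟩
  k + brick q m (suc j′)   ∎
  where open ≡-Reasoning

brickRun : ℕ → ℕ → ℕ → ℕ
brickRun N zero    i = i
brickRun N (suc t) i = brick (isEven t) N (brickRun N t i)

brickRun-< : ∀ N t i → i < N → brickRun N t i < N
brickRun-< N zero    i i<N = i<N
brickRun-< N (suc t) i i<N = brick-< (isEven t) N _ (brickRun-< N t i i<N)

climb : ∀ N s t {i j} → brickRun N s i ≡ j → isEven j ≡ isEven s → j + t < N →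
        brickRun N (s + t) i ≡ j + t
climb N s zero {j = j} at _ _ =
  trans (cong (λ u → brickRun N u _) (+-identityʳ s)) (trans at (sym (+-identityʳ j)))
climb N s (suc t) {i} {j} at par bound = begin
  brickRun N (s + suc t) i  ≡⟨ cong (λ u → brickRun N u i) (+-suc s t) ⟩
  brickRun N (suc s + t) i  ≡⟨ climb N (suc s) t step (cong not par) bound′ ⟩
  suc j + t                 ≡⟨ sym (+-suc j t) ⟩
  j + suc t                 ∎
  where
  open ≡-Reasoning
  bound′ : suc j + t < N
  bound′ = subst (_< N) (+-suc j t) bound
  step : brickRun N (suc s) i ≡ suc j
  step = trans (cong (brick (isEven s) N) at) (brick-up par (≤-<-trans (s≤s (m≤m+n j t)) bound′))

descend : ∀ N s t {i r} → brickRun N s i ≡ t + r → isEven (t + r) ≡ not (isEven s) →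
          brickRun N (s + t) i ≡ r
descend N s zero    at _ = trans (cong (λ u → brickRun N u _) (+-identityʳ s)) at
descend N s (suc t) {i} {r} at par = begin
  brickRun N (s + suc t) i  ≡⟨ cong (λ u → brickRun N u i) (+-suc s t) ⟩
  brickRun N (suc s + t) i  ≡⟨ descend N (suc s) t step (not-injective par′) ⟩
  r                         ∎
  where
  open ≡-Reasoning
  step : brickRun N (suc s) i ≡ t + r
  step = trans (cong (brick (isEven s) N) at) (brick-down par)
  par′ : not (isEven (t + r)) ≡ not (not (not (isEven s)))
  par′ = trans par (sym (not-involutive (not (isEven s))))

-- N = M + 1 rounds reverse the path: the agent starting at i ends at M - i.  An even agent climbs to the top, waits one round and
-- descends; an odd agent descends to the bottom, waits and climbs.
brickRun-reverses : ∀ M i → i ≤ M → brickRun (suc M) (suc M) i + i ≡ M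
brickRun-reverses M i i≤M with isEven i in evi
... | true = begin
  brickRun N (suc M) i + i  ≡⟨ cong (λ u → brickRun N (suc u) i + i) (sym d+i) ⟩
  brickRun N (suc d + i) i + i ≡⟨ cong (_+ i) (descend N (suc d) i waited descending) ⟩
  d + i                     ≡⟨ d+i ⟩
  M                         ∎
  where
  open ≡-Reasoning
  N : ℕ
  N = suc M
  d : ℕ
  d = M ∸ i
  i+d : i + d ≡ M
  i+d = m+[n∸m]≡n i≤M
  d+i : d + i ≡ M
  d+i = trans (+-comm d i) i+d
  atTop : brickRun N d i ≡ i + d
  atTop = climb N 0 d refl evi (s≤s (≤-reflexive i+d))
  waited : brickRun N (suc d) i ≡ i + d
  waited = trans (cong (brick (isEven d) N) atTop)
                 (brick-stay (isEven-+-even i d evi) (s≤s (≤-reflexive (sym i+d))))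
  descending : isEven (i + d) ≡ not (isEven (suc d))
  descending = trans (isEven-+-even i d evi) (sym (not-involutive (isEven d)))
... | false = begin
  brickRun N (suc M) i + i  ≡⟨ cong (λ u → brickRun N (suc u) i + i) (sym i+d) ⟩
  brickRun N (suc i + d) i + i ≡⟨ cong (_+ i) (climb N (suc i) d waited ascending (s≤s (m∸n≤m M i))) ⟩
  d + i                     ≡⟨ trans (+-comm d i) i+d ⟩
  M                         ∎
  where
  open ≡-Reasoning
  N : ℕ
  N = suc M
  d : ℕ
  d = M ∸ i
  i+d : i + d ≡ M
  i+d = m+[n∸m]≡n i≤M
  atBottom : brickRun N i i ≡ 0
  atBottom = descend N 0 i (sym (+-identityʳ i)) (trans (cong isEven (+-identityʳ i)) evi)
  waited : brickRun N (suc i) i ≡ 0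
  waited = trans (cong (brick (isEven i) N) atBottom)
                 (brick-down {isEven i} {N} {0} (sym (cong not evi)))
  ascending : isEven 0 ≡ isEven (suc i)
  ascending = sym (cong not evi)

firstFailure : (P : ℕ → Set) → Decidable P → ∀ T → P 0 → ¬ P T →
               ∃[ s ] (s < T × P s × ¬ P (suc s))
firstFailure P P? zero    p0 ¬pT = contradiction p0 ¬pT
firstFailure P P? (suc T) p0 ¬pT with P? T
... | yes pT  = T , ≤-refl , pT , ¬pT
... | no  ¬pT′ with firstFailure P P? T p0 ¬pT′
...   | s , s<T , ps , ¬ps = s , m<n⇒m<1+n s<T , ps , ¬ps

adjacentSwap : ∀ {a b a′ b′} → a < b → b′ ≤ a′ → a′ ≤ suc a → b ≤ suc b′ → a′ ≢ b′ →
               b ≡ suc a × a′ ≡ b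
adjacentSwap {a} {b} {a′} {b′} a<b b′≤a′ a′≤1+a b≤1+b′ a′≢b′ = b≡1+a , a′≡b
  where
  b≤a′ : b ≤ a′
  b≤a′ = ≤-trans b≤1+b′ (≤∧≢⇒< b′≤a′ (λ e → a′≢b′ (sym e)))
  b≡1+a : b ≡ suc a
  b≡1+a = ≤-antisym (≤-trans b≤a′ a′≤1+a) a<b
  a′≡b : a′ ≡ b
  a′≡b = ≤-antisym (≤-trans a′≤1+a (≤-reflexive (sym b≡1+a))) b≤a′

brickRun-crosses : ∀ N {i j} → i < j → j < N →
  ∃[ s ] (s < N × brickRun N s j ≡ suc (brickRun N s i) × brickRun N (suc s) i ≡ brickRun N s j)
brickRun-crosses (suc M) {i} {j} i<j j<N
  with firstFailure (λ s → brickRun N s i < brickRun N s j)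
                    (λ s → brickRun N s i <? brickRun N s j) N i<j orderReversed
  where
  N : ℕ
  N = suc M
  orderReversed : ¬ (brickRun N N i < brickRun N N j)
  orderReversed lt = <⇒≱ i<j (+-cancelˡ-≤ (brickRun N N j) j i (begin
    brickRun N N j + j  ≡⟨ trans (brickRun-reverses M j (≤-pred j<N))
                                 (sym (brickRun-reverses M i (≤-pred (<-trans i<j j<N)))) ⟩
    brickRun N N i + i  ≤⟨ +-monoˡ-≤ i (<⇒≤ lt) ⟩
    brickRun N N j + i  ∎))
    where open ≤-Reasoning
... | s , s<N , before , ¬after = s , s<N , swapped
  where
  N : ℕ
  N = suc M
  p : Bool
  p = isEven s
  a b : ℕ
  a = brickRun N s i
  b = brickRun N s j
  separate : brick p N a ≢ brick p N b
  separate e = <⇒≢ before (begin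
    a                        ≡⟨ sym (brick-involutive p N a (brickRun-< N s i (<-trans i<j j<N))) ⟩
    brick p N (brick p N a)  ≡⟨ cong (brick p N) e ⟩
    brick p N (brick p N b)  ≡⟨ brick-involutive p N b (brickRun-< N s j j<N) ⟩
    b                        ∎)
    where open ≡-Reasoning
  swapped : b ≡ suc a × brick p N a ≡ b
  swapped = adjacentSwap before (≮⇒≥ ¬after) (brick-≤ p N a) (brick-≥ p N b) separate

-- The agent
-- type Ag is kept general so that a schedule running inside a subtree can
-- move agents of the whole tree.  history lists the configurations at
-- times 0, 1, …, and final is the last one.
history : {P Ag : Set} → (P → Ag) → List (P → P) → List (P → Ag)
history c []       = c ∷ []
history c (μ ∷ ms) = c ∷ history (c ∘ μ) ms

final : {P Ag : Set} → (P → Ag) → List (P → P) → P → Ag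
final c []       = c
final c (μ ∷ ms) = final (c ∘ μ) ms

Adjacent : {P Ag : Set} → (P → P → Set) → (P → Ag) → Ag → Ag → Set
Adjacent Adj c a b = ∃[ u ] ∃[ w ] (Adj u w × c u ≡ a × c w ≡ b)

Meets : {P Ag : Set} → (P → P → Set) → List (P → P) → (P → Ag) → Ag → Ag → Set
Meets Adj ms c a b = Any (λ d → Adjacent Adj d a b) (history c ms)

module _ {P Ag : Set} where

  final-++ : ∀ (c : P → Ag) ms ns → final c (ms ++ ns) ≡ final (final c ms) ns
  final-++ c []       ns = refl
  final-++ c (μ ∷ ms) ns = final-++ (c ∘ μ) ms ns

  final-∘ : ∀ {Ag′ : Set} (g : Ag → Ag′) (c : P → Ag) ms → final (g ∘ c) ms ≡ g ∘ final c ms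
  final-∘ g c []       = refl
  final-∘ g c (μ ∷ ms) = final-∘ g (c ∘ μ) ms

module _ {P Ag : Set} {Adj : P → P → Set} where

  Meets-++ˡ : ∀ ms ns {c : P → Ag} {a b} → Meets Adj ms c a b → Meets Adj (ms ++ ns) c a b
  Meets-++ˡ []       []      (here m)  = here m
  Meets-++ˡ []       (_ ∷ _) (here m)  = here m
  Meets-++ˡ (_ ∷ ms) ns      (here m)  = here m
  Meets-++ˡ (_ ∷ ms) ns      (there m) = there (Meets-++ˡ ms ns m)

  Meets-++ʳ : ∀ ms ns {c : P → Ag} {a b} → Meets Adj ns (final c ms) a b → Meets Adj (ms ++ ns) c a b
  Meets-++ʳ []       ns m = m
  Meets-++ʳ (_ ∷ ms) ns m = there (Meets-++ʳ ms ns m)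

  Meets-sym : (∀ {u w} → Adj u w → Adj w u) → ∀ ms {c : P → Ag} {a b} →
              Meets Adj ms c a b → Meets Adj ms c b a
  Meets-sym sym-Adj ms = go ms
    where
    flipAdj : ∀ {d : P → Ag} {a b} → Adjacent Adj d a b → Adjacent Adj d b a
    flipAdj (u , w , uw , du , dw) = w , u , sym-Adj uw , dw , du
    go : ∀ ms {c : P → Ag} {a b} → Meets Adj ms c a b → Meets Adj ms c b a
    go []       (here m)  = here (flipAdj m)
    go (_ ∷ ms) (here m)  = here (flipAdj m)
    go (_ ∷ ms) (there m) = there (go ms m)

data Node : ℕ → Set where
  root  : ∀ {h} → Node h
  left  : ∀ {h} → Node h → Node (suc h)
  right : ∀ {h} → Node h → Node (suc h)

data NodeAdj : ∀ {h} → Node h → Node h → Set where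
  root-left  : ∀ {h} → NodeAdj {suc h} root (left root)
  left-root  : ∀ {h} → NodeAdj {suc h} (left root) root
  root-right : ∀ {h} → NodeAdj {suc h} root (right root)
  right-root : ∀ {h} → NodeAdj {suc h} (right root) root
  inLeft     : ∀ {h} {x y : Node h} → NodeAdj x y → NodeAdj (left x) (left y)
  inRight    : ∀ {h} {x y : Node h} → NodeAdj x y → NodeAdj (right x) (right y)

NodeAdj-sym : ∀ {h} {x y : Node h} → NodeAdj x y → NodeAdj y x
NodeAdj-sym root-left   = left-root
NodeAdj-sym left-root   = root-left
NodeAdj-sym root-right  = right-root
NodeAdj-sym right-root  = root-right
NodeAdj-sym (inLeft a)  = inLeft (NodeAdj-sym a)
NodeAdj-sym (inRight a) = inRight (NodeAdj-sym a)

NodeTree : ℕ → Graph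
NodeTree h = record { V = Node h ; Adj = NodeAdj }

-- The tree has size h = top h + 1 = 2^(h+1) - 1 nodes; top h is even.
top : ℕ → ℕ
top zero    = 0
top (suc h) = suc (top h) + suc (top h)

size : ℕ → ℕ
size h = suc (top h)

isEven-top : ∀ h → isEven (top h) ≡ true
isEven-top zero    = refl
isEven-top (suc h) = isEven-double (size h)

-- The virtual path through the tree on which brick sort is simulated:
-- the root comes first, followed by the left subtree and then the right
-- subtree, each traversed in reverse.  corank x = top h - rank x is the
-- position counted from the other end.
rank corank : ∀ {h} → Node h → ℕ
rank root              = 0
rank (left x)          = suc (corank x)
rank {suc h} (right x) = suc (size h + corank x)
corank {h} root        = top h
corank {suc h} (left x) = size h + rank x
corank (right x)       = rank x

rank+corank : ∀ {h} (x : Node h) → rank x + corank x ≡ top h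
rank+corank root = refl
rank+corank {suc h} (left x) = begin
  suc (corank x) + (size h + rank x)  ≡⟨ shuffle (corank x) (size h) (rank x) ⟩
  size h + suc (rank x + corank x)    ≡⟨ cong (λ n → size h + suc n) (rank+corank x) ⟩
  size h + size h                     ∎
  where
  open ≡-Reasoning
  shuffle : ∀ a s b → suc a + (s + b) ≡ s + suc (b + a)
  shuffle = solve-∀
rank+corank {suc h} (right x) = begin
  suc (size h + corank x) + rank x    ≡⟨ shuffle (size h) (corank x) (rank x) ⟩
  size h + suc (rank x + corank x)    ≡⟨ cong (λ n → size h + suc n) (rank+corank x) ⟩
  size h + size h                     ∎
  where
  open ≡-Reasoning
  shuffle : ∀ s a b → suc (s + a) + b ≡ s + suc (b + a)
  shuffle = solve-∀

rank-< : ∀ {h} (x : Node h) → rank x < size h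
rank-< x = s≤s (subst (rank x ≤_) (rank+corank x) (m≤m+n (rank x) (corank x)))

corank-< : ∀ {h} (x : Node h) → corank x < size h
corank-< x = s≤s (subst (corank x ≤_) (rank+corank x) (m≤n+m (corank x) (rank x)))

rank-injective   : ∀ {h} (x y : Node h) → rank x ≡ rank y → x ≡ y
corank-injective : ∀ {h} (x y : Node h) → corank x ≡ corank y → x ≡ y
rank-injective root      root      _ = refl
rank-injective (left x)  (left y)  e = cong left (corank-injective x y (suc-injective e))
rank-injective {suc h} (right x) (right y) e =
  cong right (corank-injective x y (+-cancelˡ-≡ (size h) _ _ (suc-injective e)))
rank-injective {suc h} (left x)  (right y) e =
  contradiction (subst (size h ≤_) (sym (suc-injective e)) (m≤m+n (size h) (corank y))) (<⇒≱ (corank-< x))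
rank-injective {suc h} (right x) (left y)  e =
  contradiction (subst (size h ≤_) (suc-injective e) (m≤m+n (size h) (corank x))) (<⇒≱ (corank-< y))
corank-injective x y e =
  rank-injective x y (+-cancelʳ-≡ (corank x) _ _ (trans (rank+corank x)
    (trans (sym (rank+corank y)) (cong (rank y +_) (sym e)))))

_≟ₙ_ : ∀ {h} (x y : Node h) → Dec (x ≡ y)
x ≟ₙ y with rank x ≟ rank y
... | yes e  = yes (rank-injective x y e)
... | no  ne = no (ne ∘ cong rank)

-- The last node of the path.
lastNode : ∀ h → Node h
lastNode zero    = root
lastNode (suc h) = right root

rank-lastNode : ∀ h → rank (lastNode h) ≡ top h
rank-lastNode zero    = refl
rank-lastNode (suc h) = cong suc (sym (+-suc (top h) (top h)))

corank-lastNode : ∀ h → corank (lastNode h) ≡ 0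
corank-lastNode zero    = refl
corank-lastNode (suc h) = refl

onSubtrees : ∀ {h} → (Node h → Node h) → (Node h → Node h) → Node (suc h) → Node (suc h)
onSubtrees f g root      = root
onSubtrees f g (left x)  = left (f x)
onSubtrees f g (right x) = right (g x)

swapLeft : ∀ {h} → Node (suc h) → Node (suc h)
swapLeft root            = left root
swapLeft (left root)     = root
swapLeft (left (left x)) = left (left x)
swapLeft (left (right x)) = left (right x)
swapLeft (right x)       = right x

swapRight : ∀ {h} → Node (suc h) → Node (suc h)
swapRight root              = right root
swapRight (right root)      = root
swapRight (right (left x))  = right (left x)
swapRight (right (right x)) = right (right x)
swapRight (left x)          = left x

-- In the tree of depth h+1 the virtual path has exactly one pair of
-- consecutive positions {boundary₁, boundary₂} that the two subtrees
-- cannot handle: for parity true it joins the root to the left subtree,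
-- for parity false the left subtree to the right one.
boundary₁ boundary₂ : Bool → ∀ h → Node (suc h)
boundary₁ true  h = root
boundary₁ false h = left root
boundary₂ true  h = left (lastNode h)
boundary₂ false h = right (lastNode h)

rank-boundary₂ : ∀ p h → rank (boundary₂ p h) ≡ suc (rank (boundary₁ p h))
rank-boundary₂ true  h = cong suc (corank-lastNode h)
rank-boundary₂ false h = cong suc (trans (cong (size h +_) (corank-lastNode h)) (+-identityʳ (size h)))

isEven-boundary₁ : ∀ p h → isEven (rank (boundary₁ p h)) ≡ p
isEven-boundary₁ true  h = refl
isEven-boundary₁ false h = cong not (isEven-top h)

-- The gadget: five rounds exchanging the agents on the boundary pair via
-- the root (idle rounds pad it to a uniform length).
gadget : Bool → ∀ h → List (Node (suc h) → Node (suc h))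
gadget true  zero    = swapLeft ∷ id ∷ id ∷ id ∷ id ∷ []
gadget true  (suc h) = swapLeft ∷ onSubtrees swapRight id ∷ swapLeft ∷ id ∷ id ∷ []
gadget false zero    = swapLeft ∷ swapRight ∷ swapLeft ∷ id ∷ id ∷ []
gadget false (suc h) = swapLeft ∷ swapRight ∷ onSubtrees id swapRight ∷ swapRight ∷ swapLeft ∷ []

-- Where the gadget sends each node's agent from: the agent on x at the
-- end of the gadget started on gadgetPerm p h x.
gadgetPerm : Bool → ∀ h → Node (suc h) → Node (suc h)
gadgetPerm p h = final id (gadget p h)

gadget-swaps₁ : ∀ p h → gadgetPerm p h (boundary₁ p h) ≡ boundary₂ p h
gadget-swaps₁ true  zero    = refl
gadget-swaps₁ true  (suc h) = refl
gadget-swaps₁ false zero    = refl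
gadget-swaps₁ false (suc h) = refl

gadget-swaps₂ : ∀ p h → gadgetPerm p h (boundary₂ p h) ≡ boundary₁ p h
gadget-swaps₂ true  zero    = refl
gadget-swaps₂ true  (suc h) = refl
gadget-swaps₂ false zero    = refl
gadget-swaps₂ false (suc h) = refl

gadget-fixes : ∀ p h x → x ≢ boundary₁ p h → x ≢ boundary₂ p h → gadgetPerm p h x ≡ x
gadget-fixes true  zero    root                      ≢b₁ _   = contradiction refl ≢b₁
gadget-fixes true  zero    (left root)               _   ≢b₂ = contradiction refl ≢b₂
gadget-fixes true  zero    (right root)              _   _   = refl
gadget-fixes true  (suc h) root                      ≢b₁ _   = contradiction refl ≢b₁
gadget-fixes true  (suc h) (left root)               _   _   = refl
gadget-fixes true  (suc h) (left (left x))           _   _   = refl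
gadget-fixes true  (suc h) (left (right root))       _   ≢b₂ = contradiction refl ≢b₂
gadget-fixes true  (suc h) (left (right (left x)))   _   _   = refl
gadget-fixes true  (suc h) (left (right (right x)))  _   _   = refl
gadget-fixes true  (suc h) (right x)                 _   _   = refl
gadget-fixes false zero    root                      _   _   = refl
gadget-fixes false zero    (left root)               ≢b₁ _   = contradiction refl ≢b₁
gadget-fixes false zero    (right root)              _   ≢b₂ = contradiction refl ≢b₂
gadget-fixes false (suc h) root                      _   _   = refl
gadget-fixes false (suc h) (left root)               ≢b₁ _   = contradiction refl ≢b₁
gadget-fixes false (suc h) (left (left x))           _   _   = refl
gadget-fixes false (suc h) (left (right x))          _   _   = refl
gadget-fixes false (suc h) (right root)              _   _   = refl
gadget-fixes false (suc h) (right (left x))          _   _   = refl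
gadget-fixes false (suc h) (right (right root))      _   ≢b₂ = contradiction refl ≢b₂
gadget-fixes false (suc h) (right (right (left x)))  _   _   = refl
gadget-fixes false (suc h) (right (right (right x))) _   _   = refl

gadget-meets : ∀ {Ag : Set} p h (c : Node (suc h) → Ag) →
               Meets NodeAdj (gadget p h) c (c (boundary₁ p h)) (c (boundary₂ p h))
gadget-meets true  zero    c = here (root , left root , root-left , refl , refl)
gadget-meets true  (suc h) c = there (here (left root , left (right root) , inLeft root-right , refl , refl))
gadget-meets false zero    c = there (here (root , right root , root-right , refl , refl))
gadget-meets false (suc h) c =
  there (there (here (right root , right (right root) , inRight root-right , refl , refl)))

-- A subtree is traversed in reverse, which
-- flips parity; the left one also starts at the odd offset 1, flipping it
-- back, so it runs parity p, while the right one (even offset) runs not p.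
treeBrick : Bool → ∀ h → Node h → Node h
treeBrick p zero    x = x
treeBrick p (suc h) x = gadgetPerm p h (onSubtrees (treeBrick p h) (treeBrick (not p) h) x)

Realises : Bool → ℕ → Set
Realises p h = ∀ x → rank (treeBrick p h x) ≡ brick p (size h) (rank x)

module _ {p h} (realises : Realises p h) where

  realises-corank : ∀ x → corank (treeBrick p h x) ≡ brick (not p) (size h) (corank x)
  realises-corank x = +-cancelˡ-≡ (rank y) _ _ (begin
    rank y + corank y                                   ≡⟨ rank+corank y ⟩
    top h                                               ≡⟨ sym (brick-reflect (top h) (isEven-top h) p (rank x) (corank x) (rank+corank x)) ⟩
    brick p (size h) (rank x) + brick (not p) (size h) (corank x)
                                                        ≡⟨ cong (_+ brick (not p) (size h) (corank x)) (sym (realises x)) ⟩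
    rank y + brick (not p) (size h) (corank x)          ∎)
    where
    open ≡-Reasoning
    y : Node h
    y = treeBrick p h x

  treeBrick-involutive : ∀ x → treeBrick p h (treeBrick p h x) ≡ x
  treeBrick-involutive x = rank-injective _ x (begin
    rank (treeBrick p h (treeBrick p h x))  ≡⟨ realises (treeBrick p h x) ⟩
    brick p (size h) (rank (treeBrick p h x)) ≡⟨ cong (brick p (size h)) (realises x) ⟩
    brick p (size h) (brick p (size h) (rank x)) ≡⟨ brick-involutive p (size h) (rank x) (rank-< x) ⟩
    rank x                                  ∎)
    where open ≡-Reasoning

  corank-moves : ∀ {y} → treeBrick p h y ≢ y → brick (not p) (size h) (corank y) ≢ corank y
  corank-moves {y} moves e = moves (corank-injective _ y (trans (realises-corank y) e))

  treeBrick-fixed : ∀ y → treeBrick p h y ≡ y → (p ≡ false × y ≡ root) ⊎ (p ≡ true × y ≡ lastNode h)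
  treeBrick-fixed y fixed with brick-fixed p (size h) (rank y) (trans (sym (realises y)) (cong rank fixed))
  ... | inj₁ (p≡false , rank≡0) = inj₁ (p≡false , rank-injective y root rank≡0)
  ... | inj₂ (parity , s≤s top≤rank) = inj₂ (trans (sym parity) (trans (cong isEven rank≡top) (isEven-top h)) ,
                                               rank-injective y (lastNode h) (trans rank≡top (sym (rank-lastNode h))))
    where
    rank≡top : rank y ≡ top h
    rank≡top = ≤-antisym (≤-pred (rank-< y)) top≤rank

treeBrick-root : ∀ {h} → Realises false h → treeBrick false h root ≡ root
treeBrick-root {h} realises = rank-injective _ root (trans (realises root) (brick-down {false} {size h} {0} refl))

brick-top : ∀ h → brick true (size h) (top h) ≡ top h
brick-top h = brick-stay (isEven-top h) ≤-refl

treeBrick-lastNode : ∀ {h} → Realises true h → treeBrick true h (lastNode h) ≡ lastNode h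
treeBrick-lastNode {h} realises = rank-injective _ (lastNode h) (begin
  rank (treeBrick true h (lastNode h))  ≡⟨ realises (lastNode h) ⟩
  brick true (size h) (rank (lastNode h)) ≡⟨ cong (brick true (size h)) (rank-lastNode h) ⟩
  brick true (size h) (top h)           ≡⟨ brick-top h ⟩
  top h                                 ≡⟨ sym (rank-lastNode h) ⟩
  rank (lastNode h)                     ∎)
  where open ≡-Reasoning

subtreeRounds : Bool → ∀ h → Node (suc h) → Node (suc h)
subtreeRounds p h = onSubtrees (treeBrick p h) (treeBrick (not p) h)

module _ {p : Bool} {h : ℕ} (realisesL : Realises p h) (realisesR : Realises (not p) h) where

  private
    σ : Node (suc h) → Node (suc h)
    σ = subtreeRounds p h
    m N : ℕ
    m = size h
    N = size (suc h)

  subtreeRounds-involutive : ∀ x → σ (σ x) ≡ x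
  subtreeRounds-involutive root      = refl
  subtreeRounds-involutive (left y)  = cong left (treeBrick-involutive realisesL y)
  subtreeRounds-involutive (right y) = cong right (treeBrick-involutive realisesR y)

  -- A left-subtree node moved by its subtree round moves on the virtual
  -- path as the whole-path round prescribes (brick-shift, offset 1).
  rank-left-moving : ∀ y → treeBrick p h y ≢ y → rank (σ (left y)) ≡ brick p N (rank (left y))
  rank-left-moving y moves = begin
    suc (corank (treeBrick p h y))        ≡⟨ cong suc (realises-corank realisesL y) ⟩
    suc (brick (not p) m (corank y))      ≡⟨ sym (brick-shift p (not p) 1 m N (corank y) same opposite
                                               (s≤s (m≤m+n m m)) (corank-moves realisesL moves)) ⟩
    brick p N (suc (corank y))            ∎
    where
    open ≡-Reasoning
    same : ∀ i → isEven i ≡ not p → isEven (1 + i) ≡ p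
    same i e = trans (cong not e) (not-involutive p)
    opposite : ∀ i → isEven i ≡ not (not p) → isEven (1 + i) ≡ not p
    opposite i e = cong not (trans e (not-involutive p))

  -- Likewise for the right subtree, which starts at the even offset m + 1.
  rank-right-moving : ∀ y → treeBrick (not p) h y ≢ y → rank (σ (right y)) ≡ brick p N (rank (right y))
  rank-right-moving y moves = begin
    suc m + corank (treeBrick (not p) h y)    ≡⟨ cong (suc m +_) (realises-corank realisesR y) ⟩
    suc m + brick (not (not p)) m (corank y)  ≡⟨ cong (λ q → suc m + brick q m (corank y)) (not-involutive p) ⟩
    suc m + brick p m (corank y)              ≡⟨ sym (brick-shift p p (suc m) m N (corank y) same opposite
                                                   ≤-refl moves′) ⟩
    brick p N (suc m + corank y)              ∎
    where
    open ≡-Reasoning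
    evenOffset : ∀ i → isEven (suc m + i) ≡ isEven i
    evenOffset i = trans (not-involutive _) (isEven-+-even (top h) i (isEven-top h))
    same : ∀ i → isEven i ≡ p → isEven (suc m + i) ≡ p
    same i e = trans (evenOffset i) e
    opposite : ∀ i → isEven i ≡ not p → isEven (suc m + i) ≡ not p
    opposite i e = trans (evenOffset i) e
    moves′ : brick p m (corank y) ≢ corank y
    moves′ = subst (λ q → brick q m (corank y) ≢ corank y) (not-involutive p) (corank-moves realisesR moves)

left-fixed : ∀ {p h} → Realises p h → ∀ y → treeBrick p h y ≡ y →
             left y ≡ boundary₁ p h ⊎ left y ≡ boundary₂ p h
left-fixed realises y fixed with treeBrick-fixed realises y fixed
... | inj₁ (refl , refl) = inj₁ refl
... | inj₂ (refl , refl) = inj₂ refl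

right-fixed : ∀ {p h} → Realises (not p) h → ∀ y → treeBrick (not p) h y ≡ y →
              right y ≡ boundary₂ p h ⊎ (p ≡ true × y ≡ root)
right-fixed {true}  realises y fixed with treeBrick-fixed realises y fixed
... | inj₁ (_ , refl) = inj₂ (refl , refl)
... | inj₂ (() , _)
right-fixed {false} realises y fixed with treeBrick-fixed realises y fixed
... | inj₁ (() , _)
... | inj₂ (_ , refl) = inj₁ refl

subtreeRounds-boundary₁ : ∀ {p h} → Realises p h → subtreeRounds p h (boundary₁ p h) ≡ boundary₁ p h
subtreeRounds-boundary₁ {true}  _        = refl
subtreeRounds-boundary₁ {false} realises = cong left (treeBrick-root realises)

subtreeRounds-boundary₂ : ∀ {p h} → Realises p h → Realises (not p) h →
                          subtreeRounds p h (boundary₂ p h) ≡ boundary₂ p h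
subtreeRounds-boundary₂ {true}  realisesL _ = cong left (treeBrick-lastNode realisesL)
subtreeRounds-boundary₂ {false} _ realisesR = cong right (treeBrick-lastNode realisesR)

gadget-fixes-interior : ∀ {p h} → Realises p h → Realises (not p) h → ∀ x →
                        x ≢ boundary₁ p h → x ≢ boundary₂ p h →
                        gadgetPerm p h (subtreeRounds p h x) ≡ subtreeRounds p h x
gadget-fixes-interior {p} {h} realisesL realisesR x ≢b₁ ≢b₂ =
  gadget-fixes p h _ (avoids ≢b₁ (subtreeRounds-boundary₁ realisesL))
                     (avoids ≢b₂ (subtreeRounds-boundary₂ realisesL realisesR))
  where
  σ : Node (suc h) → Node (suc h)
  σ = subtreeRounds p h
  avoids : ∀ {b} → x ≢ b → σ b ≡ b → σ x ≢ b
  avoids ≢b fixed e = ≢b (trans (sym (subtreeRounds-involutive realisesL realisesR x)) (trans (cong σ e) fixed))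

rank-interior : ∀ {p h} → Realises p h → Realises (not p) h → ∀ x →
                x ≢ boundary₁ p h → x ≢ boundary₂ p h →
                rank (subtreeRounds p h x) ≡ brick p (size (suc h)) (rank x)
rank-interior {true}  _ _ root ≢b₁ _ = contradiction refl ≢b₁
rank-interior {false} {h} _ _ root _ _ = sym (brick-down {false} {size (suc h)} {0} refl)
rank-interior {p} {h} realisesL realisesR (left y) ≢b₁ ≢b₂ with treeBrick p h y ≟ₙ y
... | no moves = rank-left-moving realisesL realisesR y moves
... | yes fixed with left-fixed realisesL y fixed
...   | inj₁ e = contradiction e ≢b₁
...   | inj₂ e = contradiction e ≢b₂
rank-interior {p} {h} realisesL realisesR (right y) _ ≢b₂ with treeBrick (not p) h y ≟ₙ y
... | no moves = rank-right-moving realisesL realisesR y moves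
... | yes fixed with right-fixed realisesR y fixed
...   | inj₁ e = contradiction e ≢b₂
...   | inj₂ (refl , refl) = begin
  rank (right (treeBrick false h root))  ≡⟨ cong (rank ∘ right) (treeBrick-root realisesR) ⟩
  rank (lastNode (suc h))                ≡⟨ rank-lastNode (suc h) ⟩
  top (suc h)                            ≡⟨ sym (brick-top (suc h)) ⟩
  brick true (size (suc h)) (top (suc h)) ≡⟨ cong (brick true (size (suc h))) (sym (rank-lastNode (suc h))) ⟩
  brick true (size (suc h)) (rank (lastNode (suc h))) ∎
  where open ≡-Reasoning

brick-boundary₁ : ∀ p h → brick p (size (suc h)) (rank (boundary₁ p h)) ≡ rank (boundary₂ p h)
brick-boundary₁ p h =
  trans (brick-up (isEven-boundary₁ p h) (subst (_< size (suc h)) (rank-boundary₂ p h) (rank-< (boundary₂ p h))))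
        (sym (rank-boundary₂ p h))

brick-boundary₂ : ∀ p h → brick p (size (suc h)) (rank (boundary₂ p h)) ≡ rank (boundary₁ p h)
brick-boundary₂ p h =
  trans (cong (brick p (size (suc h))) (sym (brick-boundary₁ p h)))
        (brick-involutive p (size (suc h)) (rank (boundary₁ p h)) (rank-< (boundary₁ p h)))

treeBrick-boundary₁ : ∀ {p h} → Realises p h → treeBrick p (suc h) (boundary₁ p h) ≡ boundary₂ p h
treeBrick-boundary₁ {p} {h} realisesL =
  trans (cong (gadgetPerm p h) (subtreeRounds-boundary₁ realisesL)) (gadget-swaps₁ p h)

treeBrick-boundary₂ : ∀ {p h} → Realises p h → Realises (not p) h →
                      treeBrick p (suc h) (boundary₂ p h) ≡ boundary₁ p h
treeBrick-boundary₂ {p} {h} realisesL realisesR =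
  trans (cong (gadgetPerm p h) (subtreeRounds-boundary₂ realisesL realisesR)) (gadget-swaps₂ p h)

realises-step : ∀ p h → Realises p h → Realises (not p) h → Realises p (suc h)
realises-step p h realisesL realisesR x with x ≟ₙ boundary₁ p h | x ≟ₙ boundary₂ p h
... | yes refl | _ =
  trans (cong rank (treeBrick-boundary₁ realisesL)) (sym (brick-boundary₁ p h))
... | no _ | yes refl =
  trans (cong rank (treeBrick-boundary₂ realisesL realisesR)) (sym (brick-boundary₂ p h))
... | no ≢b₁ | no ≢b₂ =
  trans (cong rank (gadget-fixes-interior realisesL realisesR x ≢b₁ ≢b₂))
        (rank-interior realisesL realisesR x ≢b₁ ≢b₂)

treeBrick-realises : ∀ p h → Realises p h
treeBrick-realises true  zero    root = refl
treeBrick-realises false zero    root = refl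
treeBrick-realises p     (suc h)      = realises-step p h (treeBrick-realises p h) (treeBrick-realises (not p) h)

inParallel : ∀ {h} → List (Node h → Node h) → List (Node h → Node h) → List (Node (suc h) → Node (suc h))
inParallel []       []       = []
inParallel []       (g ∷ gs) = onSubtrees id g ∷ inParallel [] gs
inParallel (f ∷ fs) []       = onSubtrees f id ∷ inParallel fs []
inParallel (f ∷ fs) (g ∷ gs) = onSubtrees f g ∷ inParallel fs gs

module _ {h : ℕ} {Ag : Set} where

  adjacent-left : ∀ {d : Node (suc h) → Ag} {a b} → Adjacent NodeAdj (d ∘ left) a b → Adjacent NodeAdj d a b
  adjacent-left (u , w , uw , du , dw) = left u , left w , inLeft uw , du , dw

  adjacent-right : ∀ {d : Node (suc h) → Ag} {a b} → Adjacent NodeAdj (d ∘ right) a b → Adjacent NodeAdj d a b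
  adjacent-right (u , w , uw , du , dw) = right u , right w , inRight uw , du , dw

  final-inParallel-root : ∀ (c : Node (suc h) → Ag) fs gs → final c (inParallel fs gs) root ≡ c root
  final-inParallel-root c []       []       = refl
  final-inParallel-root c []       (g ∷ gs) = final-inParallel-root (c ∘ onSubtrees id g) [] gs
  final-inParallel-root c (f ∷ fs) []       = final-inParallel-root (c ∘ onSubtrees f id) fs []
  final-inParallel-root c (f ∷ fs) (g ∷ gs) = final-inParallel-root (c ∘ onSubtrees f g) fs gs

  final-inParallel-left : ∀ (c : Node (suc h) → Ag) fs gs x →
                          final c (inParallel fs gs) (left x) ≡ final (c ∘ left) fs x
  final-inParallel-left c []       []       x = refl
  final-inParallel-left c []       (g ∷ gs) x = final-inParallel-left (c ∘ onSubtrees id g) [] gs x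
  final-inParallel-left c (f ∷ fs) []       x = final-inParallel-left (c ∘ onSubtrees f id) fs [] x
  final-inParallel-left c (f ∷ fs) (g ∷ gs) x = final-inParallel-left (c ∘ onSubtrees f g) fs gs x

  final-inParallel-right : ∀ (c : Node (suc h) → Ag) fs gs x →
                           final c (inParallel fs gs) (right x) ≡ final (c ∘ right) gs x
  final-inParallel-right c []       []       x = refl
  final-inParallel-right c []       (g ∷ gs) x = final-inParallel-right (c ∘ onSubtrees id g) [] gs x
  final-inParallel-right c (f ∷ fs) []       x = final-inParallel-right (c ∘ onSubtrees f id) fs [] x
  final-inParallel-right c (f ∷ fs) (g ∷ gs) x = final-inParallel-right (c ∘ onSubtrees f g) fs gs x

  Meets-inParallel-left : ∀ (c : Node (suc h) → Ag) fs gs {a b} →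
                          Meets NodeAdj fs (c ∘ left) a b → Meets NodeAdj (inParallel fs gs) c a b
  Meets-inParallel-left c []       []       (here m) = here (adjacent-left m)
  Meets-inParallel-left c []       (_ ∷ _)  (here m) = here (adjacent-left m)
  Meets-inParallel-left c (_ ∷ _)  []       (here m) = here (adjacent-left m)
  Meets-inParallel-left c (_ ∷ _)  (_ ∷ _)  (here m) = here (adjacent-left m)
  Meets-inParallel-left c (f ∷ fs) []       (there m) = there (Meets-inParallel-left (c ∘ onSubtrees f id) fs [] m)
  Meets-inParallel-left c (f ∷ fs) (g ∷ gs) (there m) = there (Meets-inParallel-left (c ∘ onSubtrees f g) fs gs m)

  Meets-inParallel-right : ∀ (c : Node (suc h) → Ag) fs gs {a b} →
                           Meets NodeAdj gs (c ∘ right) a b → Meets NodeAdj (inParallel fs gs) c a b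
  Meets-inParallel-right c []       []       (here m) = here (adjacent-right m)
  Meets-inParallel-right c []       (_ ∷ _)  (here m) = here (adjacent-right m)
  Meets-inParallel-right c (_ ∷ _)  []       (here m) = here (adjacent-right m)
  Meets-inParallel-right c (_ ∷ _)  (_ ∷ _)  (here m) = here (adjacent-right m)
  Meets-inParallel-right c []       (g ∷ gs) (there m) = there (Meets-inParallel-right (c ∘ onSubtrees id g) [] gs m)
  Meets-inParallel-right c (f ∷ fs) (g ∷ gs) (there m) = there (Meets-inParallel-right (c ∘ onSubtrees f g) fs gs m)

brickSchedule : Bool → ∀ h → List (Node h → Node h)
brickSchedule p zero    = []
brickSchedule p (suc h) = gadget p h ++ inParallel (brickSchedule p h) (brickSchedule (not p) h)

final-gadget : ∀ {Ag : Set} p h (c : Node (suc h) → Ag) → final c (gadget p h) ≡ c ∘ gadgetPerm p h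
final-gadget p h c = final-∘ c id (gadget p h)

final-brickSchedule : ∀ {Ag : Set} p h (c : Node h → Ag) x → final c (brickSchedule p h) x ≡ c (treeBrick p h x)
final-brickSchedule p zero    c x = refl
final-brickSchedule {Ag} p (suc h) c x = trans (cong-app (final-++ c (gadget p h) (inParallel fs gs)) x) (afterGadget x)
  where
  fs gs : List (Node h → Node h)
  fs = brickSchedule p h
  gs = brickSchedule (not p) h
  c′ : Node (suc h) → Ag
  c′ = final c (gadget p h)
  afterGadget : ∀ x → final c′ (inParallel fs gs) x ≡ c (treeBrick p (suc h) x)
  afterGadget root      = trans (final-inParallel-root c′ fs gs) (cong-app (final-gadget p h c) root)
  afterGadget (left y)  = trans (final-inParallel-left c′ fs gs y)
    (trans (final-brickSchedule p h (c′ ∘ left) y) (cong-app (final-gadget p h c) (left (treeBrick p h y))))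
  afterGadget (right y) = trans (final-inParallel-right c′ fs gs y)
    (trans (final-brickSchedule (not p) h (c′ ∘ right) y) (cong-app (final-gadget p h c) (right (treeBrick (not p) h y))))

-- Every pair of agents exchanged by treeBrick meets while brickSchedule
-- runs: the boundary pair inside the gadget, the others inside a subtree.
brickSchedule-meets : ∀ {Ag : Set} p h x (c : Node h → Ag) → treeBrick p h x ≢ x →
                      Meets NodeAdj (brickSchedule p h) c (c x) (c (treeBrick p h x))
brickSchedule-meets p zero x c moves = contradiction refl moves
brickSchedule-meets {Ag} p (suc h) x c moves with x ≟ₙ boundary₁ p h | x ≟ₙ boundary₂ p h
... | yes refl | _ =
  Meets-++ˡ (gadget p h) _
    (subst (Meets NodeAdj (gadget p h) c (c (boundary₁ p h)))
           (cong c (sym (treeBrick-boundary₁ (treeBrick-realises p h))))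
           (gadget-meets p h c))
... | no _ | yes refl =
  Meets-++ˡ (gadget p h) _
    (subst (Meets NodeAdj (gadget p h) c (c (boundary₂ p h)))
           (cong c (sym (treeBrick-boundary₂ (treeBrick-realises p h) (treeBrick-realises (not p) h))))
           (Meets-sym NodeAdj-sym (gadget p h) (gadget-meets p h c)))
... | no ≢b₁ | no ≢b₂ =
  Meets-++ʳ (gadget p h) _ (subst₂ (Meets NodeAdj (inParallel fs gs) c′) start end (inSubtree x subtreeMoves))
  where
  fs gs : List (Node h → Node h)
  fs = brickSchedule p h
  gs = brickSchedule (not p) h
  c′ : Node (suc h) → Ag
  c′ = final c (gadget p h)
  σ : Node (suc h) → Node (suc h)
  σ = subtreeRounds p h
  start : c′ x ≡ c x
  start = trans (cong-app (final-gadget p h c) x) (cong c (gadget-fixes p h x ≢b₁ ≢b₂))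
  end : c′ (σ x) ≡ c (treeBrick p (suc h) x)
  end = cong-app (final-gadget p h c) (σ x)
  subtreeMoves : σ x ≢ x
  subtreeMoves e = moves (trans (gadget-fixes-interior (treeBrick-realises p h) (treeBrick-realises (not p) h) x ≢b₁ ≢b₂) e)
  inSubtree : ∀ x → σ x ≢ x → Meets NodeAdj (inParallel fs gs) c′ (c′ x) (c′ (σ x))
  inSubtree root      ne = contradiction refl ne
  inSubtree (left y)  ne = Meets-inParallel-left c′ fs gs (brickSchedule-meets p h y (c′ ∘ left) (ne ∘ cong left))
  inSubtree (right y) ne = Meets-inParallel-right c′ fs gs (brickSchedule-meets (not p) h y (c′ ∘ right) (ne ∘ cong right))

id-matching : ∀ {h} → IsMatching (NodeTree h) id
id-matching = (λ _ → refl) , (λ _ → inj₁ refl)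

onSubtrees-matching : ∀ {h} {f g : Node h → Node h} → IsMatching (NodeTree h) f → IsMatching (NodeTree h) g →
                      IsMatching (NodeTree (suc h)) (onSubtrees f g)
onSubtrees-matching {f = f} {g} (f-inv , f-adj) (g-inv , g-adj) = involutive , alongEdges
  where
  involutive : ∀ x → onSubtrees f g (onSubtrees f g x) ≡ x
  involutive root      = refl
  involutive (left y)  = cong left (f-inv y)
  involutive (right y) = cong right (g-inv y)
  alongEdges : ∀ x → onSubtrees f g x ≡ x ⊎ NodeAdj x (onSubtrees f g x)
  alongEdges root = inj₁ refl
  alongEdges (left y) with f-adj y
  ... | inj₁ e = inj₁ (cong left e)
  ... | inj₂ a = inj₂ (inLeft a)
  alongEdges (right y) with g-adj y
  ... | inj₁ e = inj₁ (cong right e)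
  ... | inj₂ a = inj₂ (inRight a)

swapLeft-matching : ∀ {h} → IsMatching (NodeTree (suc h)) swapLeft
swapLeft-matching = involutive , alongEdges
  where
  involutive : ∀ x → swapLeft (swapLeft x) ≡ x
  involutive root             = refl
  involutive (left root)      = refl
  involutive (left (left x))  = refl
  involutive (left (right x)) = refl
  involutive (right x)        = refl
  alongEdges : ∀ x → swapLeft x ≡ x ⊎ NodeAdj x (swapLeft x)
  alongEdges root             = inj₂ root-left
  alongEdges (left root)      = inj₂ left-root
  alongEdges (left (left x))  = inj₁ refl
  alongEdges (left (right x)) = inj₁ refl
  alongEdges (right x)        = inj₁ refl

swapRight-matching : ∀ {h} → IsMatching (NodeTree (suc h)) swapRight
swapRight-matching = involutive , alongEdges
  where
  involutive : ∀ x → swapRight (swapRight x) ≡ x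
  involutive root              = refl
  involutive (right root)      = refl
  involutive (right (left x))  = refl
  involutive (right (right x)) = refl
  involutive (left x)          = refl
  alongEdges : ∀ x → swapRight x ≡ x ⊎ NodeAdj x (swapRight x)
  alongEdges root              = inj₂ root-right
  alongEdges (right root)      = inj₂ right-root
  alongEdges (right (left x))  = inj₁ refl
  alongEdges (right (right x)) = inj₁ refl
  alongEdges (left x)          = inj₁ refl

gadget-matchings : ∀ p h → All (IsMatching (NodeTree (suc h))) (gadget p h)
gadget-matchings true  zero    = swapLeft-matching ∷ id-matching ∷ id-matching ∷ id-matching ∷ id-matching ∷ []
gadget-matchings true  (suc h) = swapLeft-matching ∷ onSubtrees-matching swapRight-matching id-matching
                                 ∷ swapLeft-matching ∷ id-matching ∷ id-matching ∷ []
gadget-matchings false zero    = swapLeft-matching ∷ swapRight-matching ∷ swapLeft-matching ∷ id-matching ∷ id-matching ∷ []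
gadget-matchings false (suc h) = swapLeft-matching ∷ swapRight-matching ∷ onSubtrees-matching id-matching swapRight-matching
                                 ∷ swapRight-matching ∷ swapLeft-matching ∷ []

inParallel-matchings : ∀ {h} {fs gs : List (Node h → Node h)} →
                       All (IsMatching (NodeTree h)) fs → All (IsMatching (NodeTree h)) gs →
                       All (IsMatching (NodeTree (suc h))) (inParallel fs gs)
inParallel-matchings []       []       = []
inParallel-matchings []       (g ∷ gs) = onSubtrees-matching id-matching g ∷ inParallel-matchings [] gs
inParallel-matchings (f ∷ fs) []       = onSubtrees-matching f id-matching ∷ inParallel-matchings fs []
inParallel-matchings (f ∷ fs) (g ∷ gs) = onSubtrees-matching f g ∷ inParallel-matchings fs gs

brickSchedule-matchings : ∀ p h → All (IsMatching (NodeTree h)) (brickSchedule p h)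
brickSchedule-matchings p zero    = []
brickSchedule-matchings p (suc h) =
  ++⁺ (gadget-matchings p h) (inParallel-matchings (brickSchedule-matchings p h) (brickSchedule-matchings (not p) h))

inParallel-length : ∀ {h} (fs gs : List (Node h → Node h)) → length fs ≡ length gs →
                    length (inParallel fs gs) ≡ length fs
inParallel-length []       []       _ = refl
inParallel-length (f ∷ fs) (g ∷ gs) e = cong suc (inParallel-length fs gs (suc-injective e))

gadget-length : ∀ p h → length (gadget p h) ≡ 5
gadget-length true  zero    = refl
gadget-length true  (suc h) = refl
gadget-length false zero    = refl
gadget-length false (suc h) = refl

brickSchedule-length : ∀ p h → length (brickSchedule p h) ≡ 5 * h
brickSchedule-length p zero    = refl
brickSchedule-length p (suc h) = begin
  length (gadget p h ++ inParallel fs gs)     ≡⟨ length-++ (gadget p h) ⟩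
  length (gadget p h) + length (inParallel fs gs)
    ≡⟨ cong₂ _+_ (gadget-length p h) (inParallel-length fs gs sameLength) ⟩
  5 + length fs                               ≡⟨ cong (5 +_) (brickSchedule-length p h) ⟩
  5 + 5 * h                                   ≡⟨ sym (*-suc 5 h) ⟩
  5 * suc h                                   ∎
  where
  open ≡-Reasoning
  fs gs : List (Node h → Node h)
  fs = brickSchedule p h
  gs = brickSchedule (not p) h
  sameLength : length fs ≡ length gs
  sameLength = trans (brickSchedule-length p h) (sym (brickSchedule-length (not p) h))

sortSchedule : ∀ h → ℕ → List (Node h → Node h)
sortSchedule h zero    = []
sortSchedule h (suc t) = sortSchedule h t ++ brickSchedule (isEven t) h

trajectory : ∀ h → ℕ → Node h → Node h
trajectory h zero    x = x
trajectory h (suc t) x = treeBrick (isEven t) h (trajectory h t x)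

rank-trajectory : ∀ h t x → rank (trajectory h t x) ≡ brickRun (size h) t (rank x)
rank-trajectory h zero    x = refl
rank-trajectory h (suc t) x =
  trans (treeBrick-realises (isEven t) h (trajectory h t x))
        (cong (brick (isEven t) (size h)) (rank-trajectory h t x))

final-sortSchedule : ∀ h t x → final id (sortSchedule h t) (trajectory h t x) ≡ x
final-sortSchedule h zero    x = refl
final-sortSchedule h (suc t) x = begin
  final id (sortSchedule h t ++ brickSchedule p h) (treeBrick p h y)
    ≡⟨ cong-app (final-++ id (sortSchedule h t) (brickSchedule p h)) (treeBrick p h y) ⟩
  final (final id (sortSchedule h t)) (brickSchedule p h) (treeBrick p h y)
    ≡⟨ final-brickSchedule p h (final id (sortSchedule h t)) (treeBrick p h y) ⟩
  final id (sortSchedule h t) (treeBrick p h (treeBrick p h y))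
    ≡⟨ cong (final id (sortSchedule h t)) (treeBrick-involutive (treeBrick-realises p h) y) ⟩
  final id (sortSchedule h t) y
    ≡⟨ final-sortSchedule h t x ⟩
  x ∎
  where
  open ≡-Reasoning
  p : Bool
  p = isEven t
  y : Node h
  y = trajectory h t x

sortSchedule-prefix : ∀ h s t {a b : Node h} → s ≤ t →
                      Meets NodeAdj (sortSchedule h s) id a b → Meets NodeAdj (sortSchedule h t) id a b
sortSchedule-prefix h s zero    z≤n m = m
sortSchedule-prefix h s (suc t) s≤1+t m with m≤n⇒m<n∨m≡n s≤1+t
... | inj₁ (s≤s s≤t) = Meets-++ˡ (sortSchedule h t) (brickSchedule (isEven t) h) (sortSchedule-prefix h s t s≤t m)
... | inj₂ refl      = m

-- Agents a, b with rank a < rank b meet: at the round s where brick sort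
-- exchanges them they stand on x and treeBrick x, and meet during it.
sortSchedule-meets-ordered : ∀ h (a b : Node h) → rank a < rank b →
                             Meets NodeAdj (sortSchedule h (size h)) id a b
sortSchedule-meets-ordered h a b a<b
  with brickRun-crosses (size h) a<b (rank-< b)
... | s , s<N , adjacent , exchanged =
  sortSchedule-prefix h (suc s) (size h) s<N
    (Meets-++ʳ (sortSchedule h s) (brickSchedule p h)
      (subst₂ (Meets NodeAdj (brickSchedule p h) c) (final-sortSchedule h s a) agentB
        (brickSchedule-meets p h x c moves)))
  where
  p : Bool
  p = isEven s
  x y : Node h
  x = trajectory h s a
  y = trajectory h s b
  c : Node h → Node h
  c = final id (sortSchedule h s)
  x↦y : treeBrick p h x ≡ y
  x↦y = rank-injective _ y (begin
    rank (treeBrick p h x)                     ≡⟨ treeBrick-realises p h x ⟩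
    brick p (size h) (rank x)                  ≡⟨ cong (brick p (size h)) (rank-trajectory h s a) ⟩
    brickRun (size h) (suc s) (rank a)         ≡⟨ exchanged ⟩
    brickRun (size h) s (rank b)               ≡⟨ sym (rank-trajectory h s b) ⟩
    rank y                                     ∎)
    where open ≡-Reasoning
  moves : treeBrick p h x ≢ x
  moves e = 1+n≢n (begin
    suc (rank x)                  ≡⟨ cong suc (rank-trajectory h s a) ⟩
    suc (brickRun (size h) s (rank a)) ≡⟨ sym adjacent ⟩
    brickRun (size h) s (rank b)  ≡⟨ sym (rank-trajectory h s b) ⟩
    rank y                        ≡⟨ cong rank (trans (sym x↦y) e) ⟩
    rank x                        ∎)
    where open ≡-Reasoning
  agentB : c (treeBrick p h x) ≡ b
  agentB = trans (cong c x↦y) (final-sortSchedule h s b)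

sortSchedule-meets : ∀ h (a b : Node h) → a ≢ b → Meets NodeAdj (sortSchedule h (size h)) id a b
sortSchedule-meets h a b a≢b with <-cmp (rank a) (rank b)
... | tri< a<b _ _ = sortSchedule-meets-ordered h a b a<b
... | tri≈ _ e _   = contradiction (rank-injective a b e) a≢b
... | tri> _ _ b<a = Meets-sym NodeAdj-sym (sortSchedule h (size h)) (sortSchedule-meets-ordered h b a b<a)

sortSchedule-matchings : ∀ h t → All (IsMatching (NodeTree h)) (sortSchedule h t)
sortSchedule-matchings h zero    = []
sortSchedule-matchings h (suc t) = ++⁺ (sortSchedule-matchings h t) (brickSchedule-matchings (isEven t) h)

sortSchedule-length : ∀ h t → length (sortSchedule h t) ≡ t * (5 * h)
sortSchedule-length h zero    = refl
sortSchedule-length h (suc t) = begin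
  length (sortSchedule h t ++ brickSchedule (isEven t) h)
    ≡⟨ length-++ (sortSchedule h t) ⟩
  length (sortSchedule h t) + length (brickSchedule (isEven t) h)
    ≡⟨ cong₂ _+_ (sortSchedule-length h t) (brickSchedule-length (isEven t) h) ⟩
  t * (5 * h) + 5 * h ≡⟨ +-comm (t * (5 * h)) (5 * h) ⟩
  suc t * (5 * h)     ∎
  where open ≡-Reasoning

history≡configs : ∀ {A : Set} (c : A → A) ms → history c ms ≡ configs c ms
history≡configs c []       = refl
history≡configs c (μ ∷ ms) = cong (c ∷_) (history≡configs (c ∘ μ) ms)

Meets⇒Acquainted : ∀ G ms {a b} → Meets (Adj G) ms id a b → Acquainted G ms a b
Meets⇒Acquainted G ms {a} {b} = subst (Any (λ d → Adjacent (Adj G) d a b)) (history≡configs id ms)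

nodeTree-AC : ∀ h → AC≤ (NodeTree h) (5 * size h * h)
nodeTree-AC h = sortSchedule h (size h)
              , (sortSchedule-matchings h (size h) ,
                 λ a b a≢b → Meets⇒Acquainted (NodeTree h) _ (sortSchedule-meets h a b a≢b))
              , ≤-reflexive (trans (sortSchedule-length h (size h)) (rearrange (size h) h))
  where
  rearrange : ∀ n h → n * (5 * h) ≡ 5 * n * h
  rearrange = solve-∀

-- A bijection of vertex sets carrying edges of G to edges of H: every
-- strategy for G is, after relabelling, a strategy for H.
record SpanningEmbedding (G H : Graph) : Set where
  field
    to      : V G → V H
    from    : V H → V G
    from-to : ∀ x → from (to x) ≡ x
    to-from : ∀ v → to (from v) ≡ v
    to-adj  : ∀ {x y} → Adj G x y → Adj H (to x) (to y)

AC≤-embed : ∀ {G H k} → SpanningEmbedding G H → AC≤ G k → AC≤ H k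
AC≤-embed {G} {H} {k} e (ms , (matchings , acquainted) , length≤k) =
  map conjugate ms
  , (map⁺ (All.map conjugate-matching matchings) , acquaintedH)
  , subst (_≤ k) (sym (length-map conjugate ms)) length≤k
  where
  open SpanningEmbedding e
  conjugate : (V G → V G) → V H → V H
  conjugate μ = to ∘ μ ∘ from

  conjugate-matching : ∀ {μ} → IsMatching G μ → IsMatching H (conjugate μ)
  conjugate-matching {μ} (μ-inv , μ-adj) = involutive , alongEdges
    where
    involutive : ∀ v → conjugate μ (conjugate μ v) ≡ v
    involutive v = trans (cong (to ∘ μ) (from-to (μ (from v)))) (trans (cong to (μ-inv (from v))) (to-from v))
    alongEdges : ∀ v → conjugate μ v ≡ v ⊎ Adj H v (conjugate μ v)
    alongEdges v with μ-adj (from v)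
    ... | inj₁ e = inj₁ (trans (cong to e) (to-from v))
    ... | inj₂ a = inj₂ (subst (λ u → Adj H u (conjugate μ v)) (to-from v) (to-adj a))

  Corresponds : (V G → V G) → (V H → V H) → Set
  Corresponds c d = ∀ v → d v ≡ to (c (from v))

  adjacent : ∀ {c d a b} → Corresponds c d → Adjacent (Adj G) c a b → Adjacent (Adj H) d (to a) (to b)
  adjacent {c} {d} c~d (u , w , uw , cu , cw) = to u , to w , to-adj uw , agent cu , agent cw
    where
    agent : ∀ {x a} → c x ≡ a → d (to x) ≡ to a
    agent {x} cx = trans (c~d (to x)) (trans (cong (to ∘ c) (from-to x)) (cong to cx))

  transport : ∀ ms {c d a b} → Corresponds c d →
              Any (λ c → Adjacent (Adj G) c a b) (configs c ms) →
              Any (λ d → Adjacent (Adj H) d (to a) (to b)) (configs d (map conjugate ms))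
  transport []       c~d (here m)  = here (adjacent c~d m)
  transport (μ ∷ ms) c~d (here m)  = here (adjacent c~d m)
  transport (μ ∷ ms) {c} {d} c~d (there m) =
    there (transport ms (λ v → trans (c~d (conjugate μ v)) (cong (to ∘ c) (from-to (μ (from v))))) m)

  acquaintedH : ∀ a b → a ≢ b → Acquainted H (map conjugate ms) a b
  acquaintedH a b a≢b = subst₂ (Acquainted H (map conjugate ms)) (to-from a) (to-from b)
    (transport ms (λ v → sym (to-from v)) (acquainted (from a) (from b) (λ e → a≢b (trans (sym (to-from a)) (trans (cong to e) (to-from b))))))

-- A node is determined by its address, the string of turns from the root
-- (false = left, true = right); this identifies NodeTree h with Tree h.
address : ∀ {h} → Node h → TVert h
address root      = [] , z≤n
address (left x)  = false ∷ proj₁ (address x) , s≤s (proj₂ (address x))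
address (right x) = true  ∷ proj₁ (address x) , s≤s (proj₂ (address x))

nodeAt : ∀ h (s : List Bool) → length s ≤ h → Node h
nodeAt h       []          _       = root
nodeAt (suc h) (false ∷ s) (s≤s l) = left (nodeAt h s l)
nodeAt (suc h) (true ∷ s)  (s≤s l) = right (nodeAt h s l)

node : ∀ {h} → TVert h → Node h
node {h} (s , l) = nodeAt h s l

node-address : ∀ {h} (x : Node h) → node (address x) ≡ x
node-address root      = refl
node-address (left x)  = cong left (node-address x)
node-address (right x) = cong right (node-address x)

address-node : ∀ {h} (v : TVert h) → address (node v) ≡ v
address-node {h} (s , l) = go h s l
  where
  go : ∀ h s (l : length s ≤ h) → address (nodeAt h s l) ≡ (s , l)
  go h       []          z≤n     = refl
  go (suc h) (false ∷ s) (s≤s l) = cong (λ v → false ∷ proj₁ v , s≤s (proj₂ v)) (go h s l)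
  go (suc h) (true ∷ s)  (s≤s l) = cong (λ v → true ∷ proj₁ v , s≤s (proj₂ v)) (go h s l)

address-adj : ∀ {h} {x y : Node h} → NodeAdj x y → TreeAdj (address x) (address y)
address-adj root-left  = inj₁ (false , refl)
address-adj left-root  = inj₂ (false , refl)
address-adj root-right = inj₁ (true , refl)
address-adj right-root = inj₂ (true , refl)
address-adj (inLeft a) with address-adj a
... | inj₁ (b , e) = inj₁ (b , cong (false ∷_) e)
... | inj₂ (b , e) = inj₂ (b , cong (false ∷_) e)
address-adj (inRight a) with address-adj a
... | inj₁ (b , e) = inj₁ (b , cong (true ∷_) e)
... | inj₂ (b , e) = inj₂ (b , cong (true ∷_) e)

nodeEmbedding : ∀ h → SpanningEmbedding (NodeTree h) (Tree h)
nodeEmbedding h = record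
  { to = address ; from = node ; from-to = node-address ; to-from = address-node ; to-adj = address-adj }

size+1 : ∀ h → suc (size h) ≡ 2 ^ suc h
size+1 zero    = refl
size+1 (suc h) = begin
  suc (suc (size h + size h))  ≡⟨ cong suc (sym (+-suc (size h) (size h))) ⟩
  suc (size h) + suc (size h)  ≡⟨ cong (λ n → n + n) (size+1 h) ⟩
  2 ^ suc h + 2 ^ suc h        ≡⟨ cong (2 ^ suc h +_) (sym (+-identityʳ (2 ^ suc h))) ⟩
  2 * 2 ^ suc h                ∎
  where open ≡-Reasoning

size≡treeSize : ∀ h → size h ≡ treeSize h
size≡treeSize h = sym (begin
  2 ^ (h + 1) ∸ 1      ≡⟨ cong (λ n → 2 ^ n ∸ 1) (+-comm h 1) ⟩
  2 ^ suc h ∸ 1        ≡⟨ cong (_∸ 1) (sym (size+1 h)) ⟩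
  size h               ∎)
  where open ≡-Reasoning

depth≤log₂size : ∀ h → h ≤ ⌊log₂ size h ⌋
depth≤log₂size h = begin
  h                 ≡⟨ sym (⌊log₂[2^n]⌋≡n h) ⟩
  ⌊log₂ 2 ^ h ⌋     ≤⟨ ⌊log₂⌋-mono-≤ 2^h≤size ⟩
  ⌊log₂ size h ⌋    ∎
  where
  open ≤-Reasoning
  2^h≤size : 2 ^ h ≤ size h
  2^h≤size = +-cancelˡ-≤ 1 (2 ^ h) (size h) (begin
    1 + 2 ^ h       ≤⟨ +-monoˡ-≤ (2 ^ h) (m^n>0 2 h) ⟩
    2 ^ h + 2 ^ h   ≡⟨ cong (2 ^ h +_) (sym (+-identityʳ (2 ^ h))) ⟩
    2 ^ suc h       ≡⟨ sym (size+1 h) ⟩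
    1 + size h      ∎)

AC≤-mono : ∀ {G k k′} → k ≤ k′ → AC≤ G k → AC≤ G k′
AC≤-mono k≤k′ (ms , strategy , length≤k) = ms , strategy , ≤-trans length≤k k≤k′

proposition3p5 : ∃[ C ] ∃[ h₀ ] (∀ h → h₀ ≤ h → AC≤ (Tree h) (C * treeSize h * ⌊log₂ treeSize h ⌋))
proposition3p5 = 5 , 0 , λ h _ →
  AC≤-mono (bound h) (AC≤-embed (nodeEmbedding h) (nodeTree-AC h))
  where
  bound : ∀ h → 5 * size h * h ≤ 5 * treeSize h * ⌊log₂ treeSize h ⌋
  bound h = subst (λ n → 5 * size h * h ≤ 5 * n * ⌊log₂ n ⌋) (size≡treeSize h)
                  (*-monoʳ-≤ (5 * size h) (depth≤log₂size h))
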